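{- For every integer $n\geq 0$, $$\sum_{k=0}^n \binom{n}{k}(24\sqrt{2})^{n-k} B^*_{2k}\,B_{n-k} = 6n\bigl(C_{2n-2} - 2\sqrt{2}\,B^*_{2n-2}\bigr).$$
   Context: $B_n$ denotes the $n$-th Bernoulli number, defined by $\sum_{n\ge0}B_n\frac{z^n}{n!}=\frac{z}{e^z-1}$ (so $B_1=-1/2$). The balancing numbers $B^*_n$ are defined by $B^*_0=0$, $B^*_1=1$, $B^*_n=6B^*_{n-1}-B^*_{n-2}$ ($n\ge2$), and the Lucas-balancing numbers $C_n$ by $C_0=1$, $C_1=3$, $C_n=6C_{n-1}-C_{n-2}$ ($n\ge2$). For $n=0$ the right-hand side, which carries the factor $n$, is interpreted as $0$. -}

module Defs where

open import Data.Nat using (ℕ; zero; suc; _∸_; _≤ᵇ_)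
import Data.Nat as ℕ
open import Data.Nat.Combinatorics using (_C_)
open import Data.Integer using (ℤ; +_; -[1+_])
open import Data.Rational using (ℚ; _/_; 0ℚ; 1ℚ)
import Data.Rational as ℚ
open import Data.Bool using (if_then_else_)

Σℚ< : ℕ → (ℕ → ℚ) → ℚ
Σℚ< zero f = 0ℚ
Σℚ< (suc n) f = Σℚ< n f ℚ.+ f n

ℕ→ℚ : ℕ → ℚ
ℕ→ℚ n = (+ n) / 1

-- Bernoulli numbers (B₁ = -1/2), i.e. Σ B_n z^n/n! = z/(e^z-1).
-- Characterised by B₀ = 1 and, for m ≥ 0,
--   Σ_{k=0}^{m+1} C(m+2,k) B_k = 0,  i.e.
--   B_{m+1} = -1/(m+2) · Σ_{k=0}^{m} C(m+2,k) B_k .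
-- bernTable m k = B_k for all k ≤ m.

bernTable : ℕ → ℕ → ℚ
bernTable zero k = 1ℚ
bernTable (suc m) k =
  if k ≤ᵇ m then bernTable m k
  else ((-[1+ 0 ] / suc (suc m))
        ℚ.* Σℚ< (suc m) (λ j → ℕ→ℚ (suc (suc m) C j) ℚ.* bernTable m j))

bernoulli : ℕ → ℚ
bernoulli n = bernTable n n

balancing : ℕ → ℕ
balancing zero = 0
balancing (suc zero) = 1
balancing (suc (suc n)) = 6 ℕ.* balancing (suc n) ∸ balancing n

lucasBalancing : ℕ → ℕ
lucasBalancing zero = 1
lucasBalancing (suc zero) = 3
lucasBalancing (suc (suc n)) = 6 ℕ.* lucasBalancing (suc n) ∸ lucasBalancing n

record ℚ√2 : Set where
  constructor _+_√2
  field
    re : ℚ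
    ir : ℚ
open ℚ√2 public

infixl 6 _⊕_
infixl 7 _⊗_

_⊕_ : ℚ√2 → ℚ√2 → ℚ√2
(a + b √2) ⊕ (c + d √2) = (a ℚ.+ c) + (b ℚ.+ d) √2

_⊗_ : ℚ√2 → ℚ√2 → ℚ√2
(a + b √2) ⊗ (c + d √2) =
  (a ℚ.* c ℚ.+ (+ 2 / 1) ℚ.* (b ℚ.* d)) + (a ℚ.* d ℚ.+ b ℚ.* c) √2

ι : ℚ → ℚ√2
ι q = q + 0ℚ √2

zero√2 one√2 √2 : ℚ√2
zero√2 = ι 0ℚ
one√2 = ι 1ℚ
√2 = 0ℚ + 1ℚ √2

_^√2_ : ℚ√2 → ℕ → ℚ√2
x ^√2 zero = one√2
x ^√2 suc n = x ⊗ (x ^√2 n)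

Σ√2< : ℕ → (ℕ → ℚ√2) → ℚ√2
Σ√2< zero f = zero√2
Σ√2< (suc n) f = Σ√2< n f ⊕ f n

{-# OPTIONS --safe #-}
module Submission where

-- Binet's formula B*_j = (α^j − ᾱ^j)/(2√8) with α, ᾱ = 3 ± √8 turns the sum into
-- (Bₙ^A(α²) − Bₙ^A(ᾱ²))/(2√8), where Bₙ^A(u) = Σ_k C(n,k) u^k A^(n−k) B_(n−k) = A^n B_n(u/A)
-- and A = 24√2.  Since α² = ᾱ² + A, the difference equation B_n(x + 1) − B_n(x) = n x^(n−1)
-- leaves n A ᾱ^(2n−2)/(2√8) = 6n ᾱ^(2n−2), and ᾱ^j = C_j − 2√2 B*_j.  The difference
-- equation follows from the recurrence of the Bernoulli numbers by computing with binomial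
-- convolutions, that is, with products of exponential generating functions.

open import Defs
open import Algebra.Bundles using (CommutativeRing)
open import Algebra.Structures using (IsCommutativeRing)
open import Algebra.Consequences.Propositional using (comm∧idˡ⇒id; comm∧invˡ⇒inv; comm∧distrʳ⇒distrˡ)
open import Data.Fin using (toℕ)
open import Data.Nat using (ℕ; zero; suc; _∸_; _<_; _≤_; _≤ᵇ_; z≤n; s≤s)
import Data.Nat as ℕ
import Data.Nat.Properties as ℕ
open import Data.Nat.Combinatorics using (_C_; nCn≡1; nC1≡n; nCk≡nC[n∸k]; nCk+nC[k+1]≡[n+1]C[k+1])
open import Data.Bool using (T; false; true)
open import Data.Product as Product using (_,_; proj₁)
open import Data.Sum using (inj₁; inj₂)
open import Relation.Nullary using (contradiction)
open import Relation.Nullary.Decidable using (dec-true; dec-false)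
open import Data.Integer using (+_; -[1+_])
open import Data.Rational using (ℚ; 1ℚ; _/_; toℚᵘ)
import Data.Rational as ℚ
import Data.Rational.Properties as ℚ
open import Data.Rational.Solver renaming (module +-*-Solver to ℚ-Solver)
import Data.Rational.Unnormalised as ℚᵘ
import Data.Rational.Unnormalised.Properties as ℚᵘ
open import Data.Integer.Solver renaming (module +-*-Solver to ℤ-Solver)
open import Function using (_∘_)
open import Level using (0ℓ)
open import Relation.Binary.PropositionalEquality as ≡ using (_≡_)
import Algebra.Solver.Ring.NaturalCoefficients.Default

n<k⇒nCk≡0 : ∀ {n k} → n < k → n C k ≡ 0
n<k⇒nCk≡0 {n} {k} n<k with k ≤ᵇ n in eq
... | false = ≡.refl
... | true  = contradiction (ℕ.≤ᵇ⇒≤ k n (≡.subst T (≡.sym eq) _)) (ℕ.<⇒≱ n<k)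

-- The ∸ never truncates: such a sequence is nondecreasing.
module TruncatedRecurrence (q : ℕ) (s : ℕ → ℕ)
    (s-rec : ∀ j → s (2 ℕ.+ j) ≡ (2 ℕ.+ q) ℕ.* s (suc j) ∸ s j) (s₀≤s₁ : s 0 ≤ s 1) where

  open ℕ.≤-Reasoning

  monotone : ∀ j → s j ≤ s (suc j)
  monotone zero    = s₀≤s₁
  monotone (suc j) = begin
    x                                  ≤⟨ ℕ.m≤m+n x (q ℕ.* x) ⟩
    (1 ℕ.+ q) ℕ.* x                    ≡⟨ ℕ.m+n∸m≡n x ((1 ℕ.+ q) ℕ.* x) ⟨
    (2 ℕ.+ q) ℕ.* x ∸ x                ≤⟨ ℕ.∸-monoʳ-≤ ((2 ℕ.+ q) ℕ.* x) (monotone j) ⟩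
    (2 ℕ.+ q) ℕ.* x ∸ s j              ≡⟨ s-rec j ⟨
    s (2 ℕ.+ j)                        ∎
    where x = s (suc j)

  additive : ∀ j → s (2 ℕ.+ j) ℕ.+ s j ≡ (2 ℕ.+ q) ℕ.* s (suc j)
  additive j = ≡.trans (≡.cong (ℕ._+ s j) (s-rec j))
    (ℕ.m∸n+n≡m (ℕ.≤-trans (monotone j) (ℕ.m≤m+n (s (suc j)) _)))

module BinomialConvolution {c ℓ} (R : CommutativeRing c ℓ) where

  open CommutativeRing R
  open import Algebra.Properties.Semiring.Mult semiring
  open import Algebra.Properties.CommutativeMonoid.Mult +-commutativeMonoid using (×-distrib-+)
  open import Algebra.Properties.Semiring.Exp semiring using (_^_; ^-homo-*)
  open import Algebra.Properties.Semiring.Sum semiring using (sum)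
  open import Algebra.Properties.CommutativeSemiring.Binomial commutativeSemiring
    using () renaming (theorem to binomial-theorem)
  open import Algebra.Properties.CommutativeSemigroup +-commutativeSemigroup
    using (x∙yz≈y∙xz) renaming (interchange to +-interchange)
  open import Relation.Binary.Reasoning.Setoid setoid

  module Solver = Algebra.Solver.Ring.NaturalCoefficients.Default commutativeSemiring

  Seq : Set c
  Seq = ℕ → Carrier

  Σ< : ℕ → Seq → Carrier
  Σ< zero    f = 0#
  Σ< (suc n) f = Σ< n f + f n

  Σ<-cong : ∀ n {f g : Seq} → (∀ {k} → k < n → f k ≈ g k) → Σ< n f ≈ Σ< n g
  Σ<-cong zero    f≈g = refl
  Σ<-cong (suc n) f≈g = +-cong (Σ<-cong n (f≈g ∘ ℕ.m<n⇒m<1+n)) (f≈g ℕ.≤-refl)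

  Σ<-zero : ∀ n {f : Seq} → (∀ {k} → k < n → f k ≈ 0#) → Σ< n f ≈ 0#
  Σ<-zero zero    f≈0 = refl
  Σ<-zero (suc n) f≈0 = trans (+-cong (Σ<-zero n (f≈0 ∘ ℕ.m<n⇒m<1+n)) (f≈0 ℕ.≤-refl)) (+-identityˡ 0#)

  Σ<-distrib-+ : ∀ n (f g : Seq) → Σ< n (λ k → f k + g k) ≈ Σ< n f + Σ< n g
  Σ<-distrib-+ zero    f g = sym (+-identityˡ 0#)
  Σ<-distrib-+ (suc n) f g = begin
    Σ< n (λ k → f k + g k) + (f n + g n) ≈⟨ +-congʳ (Σ<-distrib-+ n f g) ⟩
    (Σ< n f + Σ< n g) + (f n + g n)      ≈⟨ +-interchange (Σ< n f) (Σ< n g) (f n) (g n) ⟩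
    (Σ< n f + f n) + (Σ< n g + g n)      ∎

  *-distribˡ-Σ< : ∀ n x (f : Seq) → x * Σ< n f ≈ Σ< n (λ k → x * f k)
  *-distribˡ-Σ< zero    x f = zeroʳ x
  *-distribˡ-Σ< (suc n) x f = trans (distribˡ x (Σ< n f) (f n)) (+-congʳ (*-distribˡ-Σ< n x f))

  Σ<-suc : ∀ n (f : Seq) → Σ< (suc n) f ≈ f 0 + Σ< n (f ∘ suc)
  Σ<-suc zero    f = trans (+-identityˡ (f 0)) (sym (+-identityʳ (f 0)))
  Σ<-suc (suc n) f = trans (+-congʳ (Σ<-suc n f)) (+-assoc (f 0) _ _)

  -- The coefficients of the product of the exponential generating functions of f and g.
  infixl 7 _⋆_
  _⋆_ : Seq → Seq → Seq
  (f ⋆ g) n = Σ< (suc n) (λ k → (n C k) × (f k * g (n ∸ k)))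

  ⋆-congʳ : ∀ {f f' : Seq} → (∀ k → f k ≈ f' k) → ∀ g n → (f ⋆ g) n ≈ (f' ⋆ g) n
  ⋆-congʳ f≈f' g n = Σ<-cong (suc n) λ {k} _ → ×-congʳ (n C k) (*-congʳ (f≈f' k))

  ⋆-congˡ : ∀ f {g g' : Seq} → (∀ k → g k ≈ g' k) → ∀ n → (f ⋆ g) n ≈ (f ⋆ g') n
  ⋆-congˡ f g≈g' n = Σ<-cong (suc n) λ {k} _ → ×-congʳ (n C k) (*-congˡ (g≈g' (n ∸ k)))

  ⋆-head : ∀ (f g : Seq) → (f ⋆ g) 0 ≈ f 0 * g 0
  ⋆-head f g = trans (+-identityˡ _) (×-homo-1 (f 0 * g 0))

  ⋆-distribʳ : ∀ (f f' g : Seq) n → ((λ k → f k + f' k) ⋆ g) n ≈ (f ⋆ g) n + (f' ⋆ g) n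
  ⋆-distribʳ f f' g n = trans (Σ<-cong (suc n) λ {k} _ → term k) (Σ<-distrib-+ (suc n) _ _)
    where
    term : ∀ k → (n C k) × ((f k + f' k) * g (n ∸ k))
               ≈ (n C k) × (f k * g (n ∸ k)) + (n C k) × (f' k * g (n ∸ k))
    term k = trans (×-congʳ (n C k) (distribʳ (g (n ∸ k)) (f k) (f' k))) (×-distrib-+ _ _ (n C k))

  ⋆-distribˡ : ∀ (f g g' : Seq) n → (f ⋆ (λ k → g k + g' k)) n ≈ (f ⋆ g) n + (f ⋆ g') n
  ⋆-distribˡ f g g' n = trans (Σ<-cong (suc n) λ {k} _ → term k) (Σ<-distrib-+ (suc n) _ _)
    where
    term : ∀ k → (n C k) × (f k * (g (n ∸ k) + g' (n ∸ k)))
               ≈ (n C k) × (f k * g (n ∸ k)) + (n C k) × (f k * g' (n ∸ k))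
    term k = trans (×-congʳ (n C k) (distribˡ (f k) (g (n ∸ k)) (g' (n ∸ k)))) (×-distrib-+ _ _ (n C k))

  ⋆-scaleˡ : ∀ x (f g : Seq) n → ((λ k → x * f k) ⋆ g) n ≈ x * (f ⋆ g) n
  ⋆-scaleˡ x f g n = sym (trans (*-distribˡ-Σ< (suc n) x _) (Σ<-cong (suc n) λ {k} _ → term k))
    where
    term : ∀ k → x * (n C k) × (f k * g (n ∸ k)) ≈ (n C k) × (x * f k * g (n ∸ k))
    term k = trans (×-comm-* (n C k) x _) (×-congʳ (n C k) (sym (*-assoc x (f k) (g (n ∸ k)))))

  ⋆-leibniz : ∀ (f g : Seq) n → (f ⋆ g) (suc n) ≈ (f ∘ suc ⋆ g) n + (f ⋆ g ∘ suc) n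
  ⋆-leibniz f g n = begin
    (f ⋆ g) (suc n)                                       ≈⟨ Σ<-suc (suc n) h ⟩
    h 0 + Σ< (suc n) (h ∘ suc)                            ≈⟨ +-congˡ (Σ<-cong (suc n) λ {k} _ → pascal k) ⟩
    h 0 + Σ< (suc n) (λ k → A k + B k)                    ≈⟨ +-congˡ (Σ<-distrib-+ (suc n) A B) ⟩
    h 0 + ((f ∘ suc ⋆ g) n + (Σ< n B + B n))              ≈⟨ +-congˡ (+-congˡ (+-congˡ Bn≈0)) ⟩
    h 0 + ((f ∘ suc ⋆ g) n + (Σ< n B + 0#))               ≈⟨ +-congˡ (+-congˡ (+-identityʳ _)) ⟩
    h 0 + ((f ∘ suc ⋆ g) n + Σ< n B)                      ≈⟨ x∙yz≈y∙xz (h 0) _ _ ⟩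
    (f ∘ suc ⋆ g) n + (h 0 + Σ< n B)                      ≈⟨ +-congˡ (+-congˡ (Σ<-cong n B≈G∘suc)) ⟩
    (f ∘ suc ⋆ g) n + (G 0 + Σ< n (G ∘ suc))              ≈⟨ +-congˡ (Σ<-suc n G) ⟨
    (f ∘ suc ⋆ g) n + (f ⋆ g ∘ suc) n                     ∎
    where
    h A B G : Seq
    h k = (suc n C k) × (f k * g (suc n ∸ k))
    A k = (n C k) × (f (suc k) * g (n ∸ k))
    B k = (n C suc k) × (f (suc k) * g (n ∸ k))
    G k = (n C k) × (f k * g (suc (n ∸ k)))
    pascal : ∀ k → h (suc k) ≈ A k + B k
    pascal k = begin
      (suc n C suc k) × x               ≡⟨ ≡.cong (_× x) (nCk+nC[k+1]≡[n+1]C[k+1] n k) ⟨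
      (n C k ℕ.+ n C suc k) × x         ≈⟨ ×-homo-+ x (n C k) (n C suc k) ⟩
      A k + B k                         ∎
      where x = f (suc k) * g (n ∸ k)
    Bn≈0 : B n ≈ 0#
    Bn≈0 = trans (×-congˡ (n<k⇒nCk≡0 (ℕ.n<1+n n))) (×-homo-0 (f (suc n) * g (n ∸ n)))
    B≈G∘suc : ∀ {k} → k < n → B k ≈ G (suc k)
    B≈G∘suc {k} k<n = ×-congʳ (n C suc k) (*-congˡ (reflexive (≡.cong g (ℕ.+-∸-assoc 1 k<n))))

  ⋆-comm : ∀ (f g : Seq) n → (f ⋆ g) n ≈ (g ⋆ f) n
  ⋆-comm f g zero    = trans (⋆-head f g) (trans (*-comm (f 0) (g 0)) (sym (⋆-head g f)))
  ⋆-comm f g (suc n) = begin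
    (f ⋆ g) (suc n)                         ≈⟨ ⋆-leibniz f g n ⟩
    (f ∘ suc ⋆ g) n + (f ⋆ g ∘ suc) n       ≈⟨ +-cong (⋆-comm (f ∘ suc) g n) (⋆-comm f (g ∘ suc) n) ⟩
    (g ⋆ f ∘ suc) n + (g ∘ suc ⋆ f) n       ≈⟨ +-comm _ _ ⟩
    (g ∘ suc ⋆ f) n + (g ⋆ f ∘ suc) n       ≈⟨ ⋆-leibniz g f n ⟨
    (g ⋆ f) (suc n)                         ∎

  ⋆-assoc : ∀ (f g h : Seq) n → (f ⋆ g ⋆ h) n ≈ (f ⋆ (g ⋆ h)) n
  ⋆-assoc f g h zero    = begin
    (f ⋆ g ⋆ h) 0        ≈⟨ trans (⋆-head (f ⋆ g) h) (*-congʳ (⋆-head f g)) ⟩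
    f 0 * g 0 * h 0      ≈⟨ *-assoc (f 0) (g 0) (h 0) ⟩
    f 0 * (g 0 * h 0)    ≈⟨ trans (⋆-head f (g ⋆ h)) (*-congˡ (⋆-head g h)) ⟨
    (f ⋆ (g ⋆ h)) 0      ∎
  ⋆-assoc f g h (suc n) = begin
    (f ⋆ g ⋆ h) (suc n)
      ≈⟨ ⋆-leibniz (f ⋆ g) h n ⟩
    ((f ⋆ g) ∘ suc ⋆ h) n + (f ⋆ g ⋆ h ∘ suc) n
      ≈⟨ +-congʳ (trans (⋆-congʳ (⋆-leibniz f g) h n) (⋆-distribʳ (f ∘ suc ⋆ g) (f ⋆ g ∘ suc) h n)) ⟩
    ((f ∘ suc ⋆ g ⋆ h) n + (f ⋆ g ∘ suc ⋆ h) n) + (f ⋆ g ⋆ h ∘ suc) n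
      ≈⟨ +-cong (+-cong (⋆-assoc (f ∘ suc) g h n) (⋆-assoc f (g ∘ suc) h n)) (⋆-assoc f g (h ∘ suc) n) ⟩
    ((f ∘ suc ⋆ (g ⋆ h)) n + (f ⋆ (g ∘ suc ⋆ h)) n) + (f ⋆ (g ⋆ h ∘ suc)) n
      ≈⟨ +-assoc _ _ _ ⟩
    (f ∘ suc ⋆ (g ⋆ h)) n + ((f ⋆ (g ∘ suc ⋆ h)) n + (f ⋆ (g ⋆ h ∘ suc)) n)
      ≈⟨ +-congˡ (trans (⋆-congˡ f (⋆-leibniz g h) n) (⋆-distribˡ f (g ∘ suc ⋆ h) (g ⋆ h ∘ suc) n)) ⟨
    (f ∘ suc ⋆ (g ⋆ h)) n + (f ⋆ (g ⋆ h) ∘ suc) n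
      ≈⟨ ⋆-leibniz f (g ⋆ h) n ⟨
    (f ⋆ (g ⋆ h)) (suc n)
      ∎

  Σ<≈sum : ∀ n (f : Seq) → Σ< n f ≈ sum {n} (f ∘ toℕ)
  Σ<≈sum zero    f = refl
  Σ<≈sum (suc n) f = trans (Σ<-suc n f) (+-congˡ (Σ<≈sum n (f ∘ suc)))

  ⋆-binomial : ∀ x y n → ((x ^_) ⋆ (y ^_)) n ≈ (x + y) ^ n
  ⋆-binomial x y n = trans (Σ<≈sum (suc n) λ k → (n C k) × (x ^ k * y ^ (n ∸ k))) (sym (binomial-theorem n x y))

  ⋆-last : ∀ (f g : Seq) n → (f ⋆ g) n ≈ Σ< n (λ k → (n C k) × (f k * g (n ∸ k))) + f n * g 0
  ⋆-last f g n = +-congˡ (begin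
    (n C n) × (f n * g (n ∸ n)) ≡⟨ ≡.cong₂ _×_ (nCn≡1 n) (≡.cong (λ m → f n * g m) (ℕ.n∸n≡0 n)) ⟩
    1 × (f n * g 0)             ≈⟨ ×-homo-1 _ ⟩
    f n * g 0                   ∎)

  δ₁ : Carrier → Seq
  δ₁ a (suc zero) = a
  δ₁ a _          = 0#

  ×-zeroˡ-* : ∀ n y → n × (0# * y) ≈ 0#
  ×-zeroˡ-* n y = trans (sym (×-comm-* n 0# y)) (zeroˡ _)

  δ₁-⋆ : ∀ a (g : Seq) n → (δ₁ a ⋆ g) (suc n) ≈ suc n × (a * g n)
  δ₁-⋆ a g n = begin
    (δ₁ a ⋆ g) (suc n)                       ≈⟨ Σ<-suc (suc n) t ⟩
    t 0 + Σ< (suc n) (t ∘ suc)               ≈⟨ +-cong (×-zeroˡ-* 1 _) (Σ<-suc n (t ∘ suc)) ⟩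
    0# + (t 1 + Σ< n (t ∘ suc ∘ suc))        ≈⟨ +-identityˡ _ ⟩
    t 1 + Σ< n (t ∘ suc ∘ suc)               ≈⟨ +-congˡ (Σ<-zero n λ {k} _ → ×-zeroˡ-* (suc n C suc (suc k)) _) ⟩
    t 1 + 0#                                 ≈⟨ +-identityʳ _ ⟩
    (suc n C 1) × (a * g n)                  ≡⟨ ≡.cong (_× (a * g n)) (nC1≡n (suc n)) ⟩
    suc n × (a * g n)                        ∎
    where
    t : Seq
    t k = (suc n C k) × (δ₁ a k * g (suc n ∸ k))

  module Bernoulli (b : Seq) (b₀ : b 0 ≈ 1#)
                   (b-rec : ∀ m → Σ< (suc (suc m)) (λ k → (suc (suc m) C k) × b k) ≈ 0#) where

    Σ<-C×b≈δ₁ : ∀ n → Σ< n (λ k → (n C k) × b k) ≈ δ₁ 1# n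
    Σ<-C×b≈δ₁ zero          = refl
    Σ<-C×b≈δ₁ (suc zero)    = trans (+-identityˡ _) (trans (×-homo-1 (b 0)) b₀)
    Σ<-C×b≈δ₁ (suc (suc m)) = b-rec m

    b⋆1≈b+δ₁ : ∀ n → (b ⋆ λ _ → 1#) n ≈ b n + δ₁ 1# n
    b⋆1≈b+δ₁ n = begin
      (b ⋆ λ _ → 1#) n                                   ≈⟨ ⋆-last b (λ _ → 1#) n ⟩
      Σ< n (λ k → (n C k) × (b k * 1#)) + b n * 1#       ≈⟨ +-cong Σ≈δ₁ (*-identityʳ (b n)) ⟩
      δ₁ 1# n + b n                                      ≈⟨ +-comm _ _ ⟩
      b n + δ₁ 1# n                                      ∎
      where
      Σ≈δ₁ : Σ< n (λ k → (n C k) × (b k * 1#)) ≈ δ₁ 1# n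
      Σ≈δ₁ = trans (Σ<-cong n λ {k} _ → ×-congʳ (n C k) (*-identityʳ (b k))) (Σ<-C×b≈δ₁ n)

    β : Carrier → Seq
    β A k = A ^ k * b k

    ^-*-δ₁ : ∀ A n → A ^ n * δ₁ 1# n ≈ δ₁ A n
    ^-*-δ₁ A zero          = zeroʳ _
    ^-*-δ₁ A (suc zero)    = trans (*-identityʳ _) (*-identityʳ A)
    ^-*-δ₁ A (suc (suc n)) = zeroʳ _

    ^⋆β≈β+δ₁ : ∀ A n → ((A ^_) ⋆ β A) n ≈ β A n + δ₁ A n
    ^⋆β≈β+δ₁ A n = begin
      ((A ^_) ⋆ β A) n                        ≈⟨ ⋆-comm (A ^_) (β A) n ⟩
      (β A ⋆ (A ^_)) n                        ≈⟨ Σ<-cong (suc n) (λ {k} k<1+n → ×-congʳ (n C k) (term (ℕ.≤-pred k<1+n))) ⟩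
      ((λ k → A ^ n * b k) ⋆ (λ _ → 1#)) n    ≈⟨ ⋆-scaleˡ (A ^ n) b (λ _ → 1#) n ⟩
      A ^ n * (b ⋆ λ _ → 1#) n                ≈⟨ *-congˡ (b⋆1≈b+δ₁ n) ⟩
      A ^ n * (b n + δ₁ 1# n)                 ≈⟨ distribˡ (A ^ n) (b n) _ ⟩
      β A n + A ^ n * δ₁ 1# n                 ≈⟨ +-congˡ (^-*-δ₁ A n) ⟩
      β A n + δ₁ A n                          ∎
      where
      term : ∀ {k} → k ≤ n → A ^ k * b k * A ^ (n ∸ k) ≈ A ^ n * b k * 1#
      term {k} k≤n = begin
        A ^ k * b k * A ^ (n ∸ k)           ≈⟨ solve 3 (λ p q x → p :* x :* q := p :* q :* x) refl (A ^ k) (A ^ (n ∸ k)) (b k) ⟩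
        A ^ k * A ^ (n ∸ k) * b k           ≈⟨ *-congʳ (^-homo-* A k (n ∸ k)) ⟨
        A ^ (k ℕ.+ (n ∸ k)) * b k           ≡⟨ ≡.cong (λ m → A ^ m * b k) (ℕ.m+[n∸m]≡n k≤n) ⟩
        A ^ n * b k                         ≈⟨ *-identityʳ _ ⟨
        A ^ n * b k * 1#                    ∎
        where open Solver

    -- bernoulliPolynomial A u n = A ^ n · B_n(u / A), homogenised so that no division occurs.
    bernoulliPolynomial : Carrier → Carrier → Seq
    bernoulliPolynomial A u = (u ^_) ⋆ β A

    bernoulliPolynomial-shift : ∀ A u n →
      bernoulliPolynomial A (u + A) (suc n) ≈ bernoulliPolynomial A u (suc n) + suc n × (A * u ^ n)
    bernoulliPolynomial-shift A u n = begin
      ((u + A) ^_ ⋆ β A) m                      ≈⟨ ⋆-congʳ (λ k → sym (⋆-binomial u A k)) (β A) m ⟩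
      ((u ^_) ⋆ (A ^_) ⋆ β A) m                 ≈⟨ ⋆-assoc (u ^_) (A ^_) (β A) m ⟩
      ((u ^_) ⋆ ((A ^_) ⋆ β A)) m               ≈⟨ ⋆-congˡ (u ^_) (^⋆β≈β+δ₁ A) m ⟩
      ((u ^_) ⋆ (λ k → β A k + δ₁ A k)) m       ≈⟨ ⋆-distribˡ (u ^_) (β A) (δ₁ A) m ⟩
      ((u ^_) ⋆ β A) m + ((u ^_) ⋆ δ₁ A) m      ≈⟨ +-congˡ (⋆-comm (u ^_) (δ₁ A) m) ⟩
      ((u ^_) ⋆ β A) m + (δ₁ A ⋆ (u ^_)) m      ≈⟨ +-congˡ (δ₁-⋆ A (u ^_) n) ⟩
      ((u ^_) ⋆ β A) m + suc n × (A * u ^ n)    ∎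
      where m = suc n

module SecondOrderRecurrence {c ℓ} (R : CommutativeRing c ℓ) (p : CommutativeRing.Carrier R) where

  open CommutativeRing R
  open import Algebra.Properties.Semiring.Mult semiring using (_×_; ×-homo-+; ×1-homo-*)
  open import Algebra.Properties.Semiring.Exp semiring using (_^_)
  open import Algebra.Properties.Group +-group using (∙-cancelʳ)
  open import Algebra.Properties.CommutativeSemigroup +-commutativeSemigroup using (interchange)
  open import Algebra.Properties.CommutativeSemigroup *-commutativeSemigroup using (x∙yz≈y∙xz)
  open import Relation.Binary.Reasoning.Setoid setoid

  record Recurrent (x : ℕ → Carrier) : Set ℓ where
    field
      step : ∀ j → x (suc (suc j)) + x j ≈ p * x (suc j)
  open Recurrent

  recurrent-unique : ∀ {x y} → Recurrent x → Recurrent y →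
                     x 0 ≈ y 0 → x 1 ≈ y 1 → ∀ j → x j ≈ y j
  recurrent-unique {x} {y} rx ry x₀≈y₀ x₁≈y₁ j = proj₁ (consecutive j)
    where
    consecutive : ∀ j → x j ≈ y j Product.× x (suc j) ≈ y (suc j)
    consecutive zero    = x₀≈y₀ , x₁≈y₁
    consecutive (suc j) with consecutive j
    ... | xj≈yj , xj+1≈yj+1 = xj+1≈yj+1 , ∙-cancelʳ (x j) _ _ (begin
      x (suc (suc j)) + x j  ≈⟨ step rx j ⟩
      p * x (suc j)          ≈⟨ *-congˡ xj+1≈yj+1 ⟩
      p * y (suc j)          ≈⟨ step ry j ⟨
      y (suc (suc j)) + y j  ≈⟨ +-congˡ xj≈yj ⟨
      y (suc (suc j)) + x j  ∎)

  recurrent-+ : ∀ {x y} → Recurrent x → Recurrent y → Recurrent (λ j → x j + y j)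
  recurrent-+ {x} {y} rx ry .step j = begin
    (x (2 ℕ.+ j) + y (2 ℕ.+ j)) + (x j + y j)  ≈⟨ interchange _ _ _ _ ⟩
    (x (2 ℕ.+ j) + x j) + (y (2 ℕ.+ j) + y j)  ≈⟨ +-cong (step rx j) (step ry j) ⟩
    p * x (suc j) + p * y (suc j)              ≈⟨ distribˡ p _ _ ⟨
    p * (x (suc j) + y (suc j))                ∎

  recurrent-scale : ∀ {x} a → Recurrent x → Recurrent (λ j → a * x j)
  recurrent-scale {x} a rx .step j = begin
    a * x (2 ℕ.+ j) + a * x j  ≈⟨ distribˡ a _ _ ⟨
    a * (x (2 ℕ.+ j) + x j)    ≈⟨ *-congˡ (step rx j) ⟩
    a * (p * x (suc j))        ≈⟨ x∙yz≈y∙xz a p _ ⟩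
    p * (a * x (suc j))        ∎

  recurrent-^ : ∀ {r} → r * r + 1# ≈ p * r → Recurrent (r ^_)
  recurrent-^ {r} r²+1≈pr .step j = begin
    r * (r * r ^ j) + r ^ j        ≈⟨ +-cong (*-assoc r r _) (*-identityˡ _) ⟨
    r * r * r ^ j + 1# * r ^ j     ≈⟨ distribʳ (r ^ j) _ _ ⟨
    (r * r + 1#) * r ^ j           ≈⟨ *-congʳ r²+1≈pr ⟩
    p * r * r ^ j                  ≈⟨ *-assoc p r _ ⟩
    p * (r * r ^ j)                ∎

  recurrent-×1 : ∀ {n} {s : ℕ → ℕ} → n × 1# ≈ p → (∀ j → s (2 ℕ.+ j) ℕ.+ s j ≡ n ℕ.* s (suc j)) →
                 Recurrent (λ j → s j × 1#)
  recurrent-×1 {n} {s} n≈p rs .step j = begin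
    s (2 ℕ.+ j) × 1# + s j × 1#    ≈⟨ ×-homo-+ 1# (s (2 ℕ.+ j)) (s j) ⟨
    (s (2 ℕ.+ j) ℕ.+ s j) × 1#     ≡⟨ ≡.cong (_× 1#) (rs j) ⟩
    (n ℕ.* s (suc j)) × 1#         ≈⟨ ×1-homo-* n (s (suc j)) ⟩
    n × 1# * s (suc j) × 1#        ≈⟨ *-congʳ n≈p ⟩
    p * s (suc j) × 1#             ∎

open import Data.Nat using (_*_)
open import Data.Rational using (0ℚ; -_)

-- The commutative ring ℚ(√2)

⊖_ : ℚ√2 → ℚ√2
⊖ (a + b √2) = (- a) + (- b) √2

two : ℚ
two = + 2 / 1

⊕-comm : ∀ x y → x ⊕ y ≡ y ⊕ x
⊕-comm (a + b √2) (c + d √2) = ≡.cong₂ _+_√2 (ℚ.+-comm a c) (ℚ.+-comm b d)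

⊕-assoc : ∀ x y z → (x ⊕ y) ⊕ z ≡ x ⊕ (y ⊕ z)
⊕-assoc (a + b √2) (c + d √2) (e + f √2) = ≡.cong₂ _+_√2 (ℚ.+-assoc a c e) (ℚ.+-assoc b d f)

⊕-identityˡ : ∀ x → zero√2 ⊕ x ≡ x
⊕-identityˡ (a + b √2) = ≡.cong₂ _+_√2 (ℚ.+-identityˡ a) (ℚ.+-identityˡ b)

⊕-inverseˡ : ∀ x → (⊖ x) ⊕ x ≡ zero√2
⊕-inverseˡ (a + b √2) = ≡.cong₂ _+_√2 (ℚ.+-inverseˡ a) (ℚ.+-inverseˡ b)

⊗-comm : ∀ x y → x ⊗ y ≡ y ⊗ x
⊗-comm (a + b √2) (c + d √2) = ≡.cong₂ _+_√2
  (solve 5 (λ t a b c d → a :* c :+ t :* (b :* d) := c :* a :+ t :* (d :* b)) ≡.refl two a b c d)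
  (solve 4 (λ a b c d → a :* d :+ b :* c := c :* b :+ d :* a) ≡.refl a b c d)
  where open ℚ-Solver

⊗-assoc : ∀ x y z → (x ⊗ y) ⊗ z ≡ x ⊗ (y ⊗ z)
⊗-assoc (a + b √2) (c + d √2) (e + f √2) = ≡.cong₂ _+_√2
  (solve 7 (λ t a b c d e f → (a :* c :+ t :* (b :* d)) :* e :+ t :* ((a :* d :+ b :* c) :* f)
      := a :* (c :* e :+ t :* (d :* f)) :+ t :* (b :* (c :* f :+ d :* e))) ≡.refl two a b c d e f)
  (solve 7 (λ t a b c d e f → (a :* c :+ t :* (b :* d)) :* f :+ (a :* d :+ b :* c) :* e
      := a :* (c :* f :+ d :* e) :+ b :* (c :* e :+ t :* (d :* f))) ≡.refl two a b c d e f)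
  where open ℚ-Solver

⊗-identityˡ : ∀ x → one√2 ⊗ x ≡ x
⊗-identityˡ (a + b √2) = ≡.cong₂ _+_√2
  (solve 3 (λ t a b → con 1ℚ :* a :+ t :* (con 0ℚ :* b) := a) ≡.refl two a b)
  (solve 2 (λ a b → con 1ℚ :* b :+ con 0ℚ :* a := b) ≡.refl a b)
  where open ℚ-Solver

⊗-distribʳ-⊕ : ∀ x y z → (y ⊕ z) ⊗ x ≡ (y ⊗ x) ⊕ (z ⊗ x)
⊗-distribʳ-⊕ (a + b √2) (c + d √2) (e + f √2) = ≡.cong₂ _+_√2
  (solve 7 (λ t a b c d e f → (c :+ e) :* a :+ t :* ((d :+ f) :* b)
      := (c :* a :+ t :* (d :* b)) :+ (e :* a :+ t :* (f :* b))) ≡.refl two a b c d e f)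
  (solve 6 (λ a b c d e f → (c :+ e) :* b :+ (d :+ f) :* a
      := (c :* b :+ d :* a) :+ (e :* b :+ f :* a)) ≡.refl a b c d e f)
  where open ℚ-Solver

ℚ√2-isCommutativeRing : IsCommutativeRing _≡_ _⊕_ _⊗_ ⊖_ zero√2 one√2
ℚ√2-isCommutativeRing = record
  { isRing = record
    { +-isAbelianGroup = record
      { isGroup = record
        { isMonoid = record
          { isSemigroup = record
            { isMagma = record { isEquivalence = ≡.isEquivalence ; ∙-cong = ≡.cong₂ _⊕_ }
            ; assoc = ⊕-assoc
            }
          ; identity = comm∧idˡ⇒id ⊕-comm ⊕-identityˡ
          }
        ; inverse = comm∧invˡ⇒inv ⊕-comm ⊕-inverseˡ
        ; ⁻¹-cong = ≡.cong ⊖_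
        }
      ; comm = ⊕-comm
      }
    ; *-cong = ≡.cong₂ _⊗_
    ; *-assoc = ⊗-assoc
    ; *-identity = comm∧idˡ⇒id ⊗-comm ⊗-identityˡ
    ; distrib = comm∧distrʳ⇒distrˡ ⊗-comm ⊗-distribʳ-⊕ , ⊗-distribʳ-⊕
    }
  ; *-comm = ⊗-comm
  }

ℚ√2-commutativeRing : CommutativeRing 0ℓ 0ℓ
ℚ√2-commutativeRing = record { isCommutativeRing = ℚ√2-isCommutativeRing }

open CommutativeRing ℚ√2-commutativeRing using (semiring; zeroˡ)
open import Algebra.Properties.Semiring.Mult semiring using (_×_; ×-assoc-*; ×1-homo-*)
open import Algebra.Properties.Semiring.Exp semiring using (_^_; ^-assocʳ)
open BinomialConvolution ℚ√2-commutativeRing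
open SecondOrderRecurrence ℚ√2-commutativeRing (6 × one√2)

toℚᵘ-/ : ∀ p d → toℚᵘ (p / suc d) ℚᵘ.≃ ℚᵘ.mkℚᵘ p d
toℚᵘ-/ p d = ℚ.toℚᵘ-fromℚᵘ (ℚᵘ.mkℚᵘ p d)

ℕ→ℚ-suc : ∀ n → ℕ→ℚ (suc n) ≡ 1ℚ ℚ.+ ℕ→ℚ n
ℕ→ℚ-suc n = ℚ.toℚᵘ-injective (begin
  toℚᵘ (ℕ→ℚ (suc n))                        ≈⟨ toℚᵘ-/ (+ suc n) 0 ⟩
  ℚᵘ.mkℚᵘ (+ suc n) 0                        ≈⟨ ℚᵘ.*≡* (solve 1 (λ x → (con (+ 1) :+ x) :* con (+ 1)
                                                := (con (+ 1) :* con (+ 1) :+ x :* con (+ 1)) :* con (+ 1)) ≡.refl (+ n)) ⟩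
  ℚᵘ.mkℚᵘ (+ 1) 0 ℚᵘ.+ ℚᵘ.mkℚᵘ (+ n) 0       ≈⟨ ℚᵘ.+-congʳ (ℚᵘ.mkℚᵘ (+ 1) 0) (toℚᵘ-/ (+ n) 0) ⟨
  toℚᵘ 1ℚ ℚᵘ.+ toℚᵘ (ℕ→ℚ n)                 ≈⟨ ℚ.toℚᵘ-homo-+ 1ℚ (ℕ→ℚ n) ⟨
  toℚᵘ (1ℚ ℚ.+ ℕ→ℚ n)                       ∎)
  where
  open ℚᵘ.≃-Reasoning
  open ℤ-Solver

ℕ→ℚ*-1/ : ∀ d → ℕ→ℚ (suc d) ℚ.* (-[1+ 0 ] / suc d) ≡ - 1ℚ
ℕ→ℚ*-1/ d = ℚ.toℚᵘ-injective (begin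
  toℚᵘ (ℕ→ℚ (suc d) ℚ.* (-[1+ 0 ] / suc d))          ≈⟨ ℚ.toℚᵘ-homo-* (ℕ→ℚ (suc d)) _ ⟩
  toℚᵘ (ℕ→ℚ (suc d)) ℚᵘ.* toℚᵘ (-[1+ 0 ] / suc d)     ≈⟨ ℚᵘ.*-cong (toℚᵘ-/ (+ suc d) 0) (toℚᵘ-/ -[1+ 0 ] d) ⟩
  ℚᵘ.mkℚᵘ (+ suc d) 0 ℚᵘ.* ℚᵘ.mkℚᵘ -[1+ 0 ] d        ≈⟨ ℚᵘ.*≡* (solve 1 (λ x → (x :* con -[1+ 0 ]) :* con (+ 1)
                                                          := con -[1+ 0 ] :* (con (+ 1) :* x)) ≡.refl (+ suc d)) ⟩
  toℚᵘ (- 1ℚ)                                         ∎)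
  where
  open ℚᵘ.≃-Reasoning
  open ℤ-Solver

ι-ℕ→ℚ : ∀ n → ι (ℕ→ℚ n) ≡ n × one√2
ι-ℕ→ℚ zero    = ≡.refl
ι-ℕ→ℚ (suc n) = ≡.trans (≡.cong ι (ℕ→ℚ-suc n)) (≡.cong (one√2 ⊕_) (ι-ℕ→ℚ n))

ι-homo-* : ∀ p q → ι (p ℚ.* q) ≡ ι p ⊗ ι q
ι-homo-* p q = ≡.cong₂ _+_√2
  (solve 3 (λ t p q → p :* q := p :* q :+ t :* (con 0ℚ :* con 0ℚ)) ≡.refl two p q)
  (solve 2 (λ p q → con 0ℚ := p :* con 0ℚ :+ con 0ℚ :* q) ≡.refl p q)
  where open ℚ-Solver

ι-Σℚ< : ∀ n f → ι (Σℚ< n f) ≡ Σ< n (ι ∘ f)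
ι-Σℚ< zero    f = ≡.refl
ι-Σℚ< (suc n) f = ≡.cong (_⊕ ι (f n)) (ι-Σℚ< n f)

Σ√2<≡Σ< : ∀ n f → Σ√2< n f ≡ Σ< n f
Σ√2<≡Σ< zero    f = ≡.refl
Σ√2<≡Σ< (suc n) f = ≡.cong (_⊕ f n) (Σ√2<≡Σ< n f)

^√2≡^ : ∀ x n → x ^√2 n ≡ x ^ n
^√2≡^ x zero    = ≡.refl
^√2≡^ x (suc n) = ≡.cong (x ⊗_) (^√2≡^ x n)

-- Bernoulli numbers

bernTable-suc : ∀ {m j} → j ≤ m → bernTable (suc m) j ≡ bernTable m j
bernTable-suc {m} {j} j≤m rewrite dec-true (j ℕ.≤? m) j≤m = ≡.refl

bernTable-stable : ∀ m {j} → j ≤ m → bernTable m j ≡ bernoulli j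
bernTable-stable zero    z≤n       = ≡.refl
bernTable-stable (suc m) j≤1+m with ℕ.m≤n⇒m<n∨m≡n j≤1+m
... | inj₁ (s≤s j≤m) = ≡.trans (bernTable-suc j≤m) (bernTable-stable m j≤m)
... | inj₂ ≡.refl    = ≡.refl

Σℚ<-cong : ∀ n {f g : ℕ → ℚ} → (∀ {k} → k < n → f k ≡ g k) → Σℚ< n f ≡ Σℚ< n g
Σℚ<-cong zero    f≡g = ≡.refl
Σℚ<-cong (suc n) f≡g = ≡.cong₂ ℚ._+_ (Σℚ<-cong n (f≡g ∘ ℕ.m<n⇒m<1+n)) (f≡g ℕ.≤-refl)

bernoulli-suc : ∀ m → bernoulli (suc m) ≡
  (-[1+ 0 ] / suc (suc m)) ℚ.* Σℚ< (suc m) (λ j → ℕ→ℚ (suc (suc m) C j) ℚ.* bernoulli j)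
bernoulli-suc m rewrite dec-false (suc m ℕ.≤? m) (ℕ.<-irrefl ≡.refl) =
  ≡.cong ((-[1+ 0 ] / suc (suc m)) ℚ.*_) (Σℚ<-cong (suc m) λ {j} j<1+m →
    ≡.cong (ℕ→ℚ (suc (suc m) C j) ℚ.*_) (bernTable-stable m (ℕ.≤-pred j<1+m)))

[1+n]Cn≡1+n : ∀ n → suc n C n ≡ suc n
[1+n]Cn≡1+n n = ≡.trans (nCk≡nC[n∸k] (ℕ.n≤1+n n)) (≡.trans (≡.cong (suc n C_) (ℕ.m+n∸n≡m 1 n)) (nC1≡n (suc n)))

bernoulli-recurrence : ∀ m → Σℚ< (suc (suc m)) (λ j → ℕ→ℚ (suc (suc m) C j) ℚ.* bernoulli j) ≡ 0ℚ
bernoulli-recurrence m = begin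
  S ℚ.+ ℕ→ℚ (d C suc m) ℚ.* bernoulli (suc m)   ≡⟨ ≡.cong₂ (λ c b → S ℚ.+ ℕ→ℚ c ℚ.* b) ([1+n]Cn≡1+n (suc m)) (bernoulli-suc m) ⟩
  S ℚ.+ ℕ→ℚ d ℚ.* (q ℚ.* S)                     ≡⟨ ≡.cong (S ℚ.+_) (ℚ.*-assoc (ℕ→ℚ d) q S) ⟨
  S ℚ.+ ℕ→ℚ d ℚ.* q ℚ.* S                       ≡⟨ ≡.cong (λ c → S ℚ.+ c ℚ.* S) (ℕ→ℚ*-1/ (suc m)) ⟩
  S ℚ.+ - 1ℚ ℚ.* S                              ≡⟨ solve 1 (λ s → s :+ con (- 1ℚ) :* s := con 0ℚ) ≡.refl S ⟩
  0ℚ                                            ∎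
  where
  open ≡.≡-Reasoning
  open ℚ-Solver
  d = suc (suc m)
  q = -[1+ 0 ] / d
  S = Σℚ< (suc m) (λ j → ℕ→ℚ (d C j) ℚ.* bernoulli j)

ι-ℕ→ℚ-⊗ : ∀ n x → ι (ℕ→ℚ n) ⊗ x ≡ n × x
ι-ℕ→ℚ-⊗ n x = ≡.trans (≡.cong (_⊗ x) (ι-ℕ→ℚ n)) (≡.trans (×-assoc-* n one√2 x) (≡.cong (n ×_) (⊗-identityˡ x)))

ι∘ℕ→ℚ-homo-* : ∀ m n → ι (ℕ→ℚ (m * n)) ≡ ι (ℕ→ℚ m) ⊗ ι (ℕ→ℚ n)
ι∘ℕ→ℚ-homo-* m n = ≡.trans (ι-ℕ→ℚ (m * n)) (≡.trans (×1-homo-* m n) (≡.sym (≡.cong₂ _⊗_ (ι-ℕ→ℚ m) (ι-ℕ→ℚ n))))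

ι-bernoulli-recurrence : ∀ m → Σ< (suc (suc m)) (λ k → (suc (suc m) C k) × ι (bernoulli k)) ≡ zero√2
ι-bernoulli-recurrence m = begin
  Σ< d (λ k → (d C k) × ι (bernoulli k))             ≡⟨ Σ<-cong d (λ {k} _ → ≡.trans (ι-homo-* (ℕ→ℚ (d C k)) (bernoulli k))
                                                                              (ι-ℕ→ℚ-⊗ (d C k) (ι (bernoulli k)))) ⟨
  Σ< d (λ k → ι (ℕ→ℚ (d C k) ℚ.* bernoulli k))       ≡⟨ ι-Σℚ< d (λ k → ℕ→ℚ (d C k) ℚ.* bernoulli k) ⟨
  ι (Σℚ< d (λ k → ℕ→ℚ (d C k) ℚ.* bernoulli k))      ≡⟨ ≡.cong ι (bernoulli-recurrence m) ⟩
  zero√2                                             ∎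
  where
  open ≡.≡-Reasoning
  d = suc (suc m)

open Bernoulli (ι ∘ bernoulli) ≡.refl ι-bernoulli-recurrence

-- Balancing numbers

-- α, ᾱ = 3 ± √8 are the roots of x² = 6x − 1, and κ = 1/(2√8) is the Binet constant of B*.
α ᾱ κ κ̄ : ℚ√2
α = (+ 3 / 1) + (+ 2 / 1) √2
ᾱ = (+ 3 / 1) + (-[1+ 1 ] / 1) √2
κ = 0ℚ + (+ 1 / 8) √2
κ̄ = 0ℚ + (-[1+ 0 ] / 8) √2

balancing-additive : ∀ j → balancing (2 ℕ.+ j) ℕ.+ balancing j ≡ 6 * balancing (suc j)
balancing-additive = TruncatedRecurrence.additive 4 balancing (λ _ → ≡.refl) z≤n

lucasBalancing-additive : ∀ j → lucasBalancing (2 ℕ.+ j) ℕ.+ lucasBalancing j ≡ 6 * lucasBalancing (suc j)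
lucasBalancing-additive = TruncatedRecurrence.additive 4 lucasBalancing (λ _ → ≡.refl) (s≤s z≤n)

balancing-Binet : ∀ j → balancing j × one√2 ≡ κ ⊗ α ^ j ⊕ κ̄ ⊗ ᾱ ^ j
balancing-Binet = recurrent-unique
  (recurrent-×1 {6} {balancing} ≡.refl balancing-additive)
  (recurrent-+ (recurrent-scale κ (recurrent-^ ≡.refl)) (recurrent-scale κ̄ (recurrent-^ ≡.refl)))
  ≡.refl ≡.refl

ᾱ-Binet : ∀ j → ᾱ ^ j ≡ ι (ℕ→ℚ (lucasBalancing j)) ⊕ ι (- ℕ→ℚ 2) ⊗ √2 ⊗ ι (ℕ→ℚ (balancing j))
ᾱ-Binet j = ≡.trans (recurrence-solution j)
  (≡.sym (≡.cong₂ (λ l b → l ⊕ ι (- ℕ→ℚ 2) ⊗ √2 ⊗ b) (ι-ℕ→ℚ (lucasBalancing j)) (ι-ℕ→ℚ (balancing j))))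
  where
  recurrence-solution : ∀ j → ᾱ ^ j ≡ lucasBalancing j × one√2 ⊕ ι (- ℕ→ℚ 2) ⊗ √2 ⊗ balancing j × one√2
  recurrence-solution = recurrent-unique (recurrent-^ ≡.refl)
    (recurrent-+ (recurrent-×1 {6} {lucasBalancing} ≡.refl lucasBalancing-additive)
                 (recurrent-scale (ι (- ℕ→ℚ 2) ⊗ √2) (recurrent-×1 {6} {balancing} ≡.refl balancing-additive)))
    ≡.refl ≡.refl

-- A = α² − ᾱ², the shift turning one Bernoulli polynomial of the Binet expansion into the other.
A : ℚ√2
A = ι (ℕ→ℚ 24) ⊗ √2

evenBalancing : Seq
evenBalancing k = ι (ℕ→ℚ (balancing (2 * k)))

evenBalancing-Binet : ∀ k → evenBalancing k ≡ κ ⊗ (α ^ 2) ^ k ⊕ κ̄ ⊗ (ᾱ ^ 2) ^ k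
evenBalancing-Binet k = begin
  ι (ℕ→ℚ (balancing (2 * k)))               ≡⟨ ι-ℕ→ℚ (balancing (2 * k)) ⟩
  balancing (2 * k) × one√2                 ≡⟨ balancing-Binet (2 * k) ⟩
  κ ⊗ α ^ (2 * k) ⊕ κ̄ ⊗ ᾱ ^ (2 * k)         ≡⟨ ≡.cong₂ (λ a b → κ ⊗ a ⊕ κ̄ ⊗ b) (^-assocʳ α 2 k) (^-assocʳ ᾱ 2 k) ⟨
  κ ⊗ (α ^ 2) ^ k ⊕ κ̄ ⊗ (ᾱ ^ 2) ^ k         ∎
  where open ≡.≡-Reasoning

evenBalancing-⋆-β : ∀ m → (evenBalancing ⋆ β A) (suc m) ≡ ι (ℕ→ℚ (6 * suc m)) ⊗ ᾱ ^ (2 * m)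
evenBalancing-⋆-β m = begin
  (evenBalancing ⋆ β A) n
    ≡⟨ ⋆-congʳ evenBalancing-Binet (β A) n ⟩
  ((λ k → κ ⊗ (α ^ 2) ^ k ⊕ κ̄ ⊗ (ᾱ ^ 2) ^ k) ⋆ β A) n
    ≡⟨ ⋆-distribʳ (λ k → κ ⊗ (α ^ 2) ^ k) (λ k → κ̄ ⊗ (ᾱ ^ 2) ^ k) (β A) n ⟩
  ((λ k → κ ⊗ (α ^ 2) ^ k) ⋆ β A) n ⊕ ((λ k → κ̄ ⊗ (ᾱ ^ 2) ^ k) ⋆ β A) n
    ≡⟨ ≡.cong₂ _⊕_ (⋆-scaleˡ κ ((α ^ 2) ^_) (β A) n) (⋆-scaleˡ κ̄ ((ᾱ ^ 2) ^_) (β A) n) ⟩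
  κ ⊗ bernoulliPolynomial A (ᾱ ^ 2 ⊕ A) n ⊕ κ̄ ⊗ P
    ≡⟨ ≡.cong (λ z → κ ⊗ z ⊕ κ̄ ⊗ P) (≡.trans (bernoulliPolynomial-shift A (ᾱ ^ 2) m)
         (≡.cong (P ⊕_) (≡.sym (ι-ℕ→ℚ-⊗ n (A ⊗ (ᾱ ^ 2) ^ m))))) ⟩
  κ ⊗ (P ⊕ X) ⊕ κ̄ ⊗ P
    ≡⟨ solve 4 (λ k k̄ p x → k :* (p :+ x) :+ k̄ :* p := (k :+ k̄) :* p :+ k :* x) ≡.refl κ κ̄ P X ⟩
  (κ ⊕ κ̄) ⊗ P ⊕ κ ⊗ X
    ≡⟨ ≡.trans (≡.cong (_⊕ κ ⊗ X) (zeroˡ P)) (⊕-identityˡ (κ ⊗ X)) ⟩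
  κ ⊗ X
    ≡⟨ solve 4 (λ k a x y → k :* (x :* (a :* y)) := (k :* a) :* x :* y) ≡.refl κ A (ι (ℕ→ℚ n)) ((ᾱ ^ 2) ^ m) ⟩
  (κ ⊗ A) ⊗ ι (ℕ→ℚ n) ⊗ (ᾱ ^ 2) ^ m
    ≡⟨ ≡.cong₂ _⊗_ (ι∘ℕ→ℚ-homo-* 6 n) (≡.sym (^-assocʳ ᾱ 2 m)) ⟨
  ι (ℕ→ℚ (6 * n)) ⊗ ᾱ ^ (2 * m)
    ∎
  where
  open ≡.≡-Reasoning
  open Solver
  n = suc m
  P = bernoulliPolynomial A (ᾱ ^ 2) n
  X = ι (ℕ→ℚ n) ⊗ (A ⊗ (ᾱ ^ 2) ^ m)

summand≡⋆-term : ∀ n k →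
  ι (ℕ→ℚ (n C k)) ⊗ (A ^√2 (n ∸ k)) ⊗ evenBalancing k ⊗ ι (bernoulli (n ∸ k))
  ≡ (n C k) × (evenBalancing k ⊗ β A (n ∸ k))
summand≡⋆-term n k = begin
  c ⊗ (A ^√2 (n ∸ k)) ⊗ f ⊗ b   ≡⟨ ≡.cong (λ a → c ⊗ a ⊗ f ⊗ b) (^√2≡^ A (n ∸ k)) ⟩
  c ⊗ (A ^ (n ∸ k)) ⊗ f ⊗ b     ≡⟨ solve 4 (λ c a f b → c :* a :* f :* b := c :* (f :* (a :* b))) ≡.refl
                                     c (A ^ (n ∸ k)) f b ⟩
  c ⊗ (f ⊗ β A (n ∸ k))         ≡⟨ ι-ℕ→ℚ-⊗ (n C k) _ ⟩
  (n C k) × (f ⊗ β A (n ∸ k))   ∎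
  where
  open ≡.≡-Reasoning
  open Solver
  c = ι (ℕ→ℚ (n C k))
  f = evenBalancing k
  b = ι (bernoulli (n ∸ k))

2[1+m]∸2≡2m : ∀ m → 2 * suc m ∸ 2 ≡ 2 * m
2[1+m]∸2≡2m m = ≡.trans (≡.cong (_∸ 2) (ℕ.*-suc 2 m)) (ℕ.m+n∸m≡n 2 (2 * m))

corollary3 : (n : ℕ) →
    Σ√2< (suc n) (λ k →
        ι (ℕ→ℚ (n C k)) ⊗ ((ι (ℕ→ℚ 24) ⊗ √2) ^√2 (n ∸ k))
          ⊗ ι (ℕ→ℚ (balancing (2 * k))) ⊗ ι (bernoulli (n ∸ k)))
    ≡ ι (ℕ→ℚ (6 * n)) ⊗ (ι (ℕ→ℚ (lucasBalancing (2 * n ∸ 2)))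
          ⊕ ι (- ℕ→ℚ 2) ⊗ √2 ⊗ ι (ℕ→ℚ (balancing (2 * n ∸ 2))))
corollary3 zero    = ≡.refl
corollary3 (suc m) = begin
  Σ√2< (suc n) summand                  ≡⟨ Σ√2<≡Σ< (suc n) summand ⟩
  Σ< (suc n) summand                    ≡⟨ Σ<-cong (suc n) (λ {k} _ → summand≡⋆-term n k) ⟩
  (evenBalancing ⋆ β A) n               ≡⟨ evenBalancing-⋆-β m ⟩
  six-n ⊗ ᾱ ^ (2 * m)                   ≡⟨ ≡.cong (λ j → six-n ⊗ ᾱ ^ j) (2[1+m]∸2≡2m m) ⟨
  six-n ⊗ ᾱ ^ (2 * n ∸ 2)               ≡⟨ ≡.cong (six-n ⊗_) (ᾱ-Binet (2 * n ∸ 2)) ⟩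
  six-n ⊗ (ι (ℕ→ℚ (lucasBalancing (2 * n ∸ 2)))
    ⊕ ι (- ℕ→ℚ 2) ⊗ √2 ⊗ ι (ℕ→ℚ (balancing (2 * n ∸ 2))))  ∎
  where
  open ≡.≡-Reasoning
  n = suc m
  six-n = ι (ℕ→ℚ (6 * n))
  summand : Seq
  summand k = ι (ℕ→ℚ (n C k)) ⊗ (A ^√2 (n ∸ k)) ⊗ evenBalancing k ⊗ ι (bernoulli (n ∸ k))
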